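{- Let $S$ be a complete extended system that has the blended conjunction rule $(\wedge)$ among its rules and that has at least one of contraction $(\mathsf C)$ or weakening $(\mathsf W)$ among its rules. Then $S$ is equivalent to a standard system.
   Context: Formulas are built from literals (propositional variables $P$ and their complements $\bar P$) using $\wedge$ and $\vee$. Negation satisfies $\neg P=\bar P$ and is extended by De Morgan's laws. A sequent is a nonempty finite multiset of formulas. A comma denotes multiset union, and $\Gamma,\Delta,\Sigma$ denote possibly empty multisets. A formula is valid if it evaluates to $1$ under every $0/1$-assignment. Rules: - Axiom: infer $P,\neg P$ from no premises. - $(\&)$: from $\Gamma,A$ and $\Gamma,B$ infer $\Gamma,A\wedge B$. - $(\otimes)$: from $\Delta,A$ and $\Sigma,B$ infer $\Delta,\Sigma,A\wedge B$. - $(\wedge)$: from $\Gamma,\Delta,A$ and $\Gamma,\Sigma,B$ infer $\Gamma,\Delta,\Sigma,A\wedge B$. - $(\oplus)$: consists of both $(\oplus_1)$ and $(\oplus_2)$, where $(\oplus_i)$ infers $\Gamma,A_1\vee A_2$ from $\Gamma,A_i$. - $(\mathrm{par})$: from $\Gamma,A,B$ infer $\Gamma,A\vee B$. - $(\mathsf W)$: from $\Gamma$ infer $\Gamma,A$. - $(\mathsf C)$: from $\Gamma,A,A$ infer $\Gamma,A$. A standard system is the axiom together with any subset of $\{(\&),(\otimes),(\oplus),(\mathrm{par}),(\mathsf W),(\mathsf C)\}$. An extended system is the axiom together with any subset of these rules and $(\wedge)$. A rule is derivable in $S$ if, for every instance of it, the conclusion is derivable in $S$ from its premises used as extra leaves.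 $S$ contains $T$ if every rule of $T$ is derivable in $S$. Two systems are equivalent if each contains the other. A system is complete if every valid formula is derivable in it. -}

module Defs where

open import Data.Nat using (ℕ)
open import Data.Bool using (Bool; true; false; _∧_; _∨_; not)
open import Data.List using (List; []; _∷_; _++_; [_])
open import Data.List.Relation.Binary.Permutation.Propositional using (_↭_)
open import Data.Product using (_×_; Σ; _,_)
open import Data.Sum using (_⊎_)
open import Data.Empty using (⊥)
open import Relation.Binary.PropositionalEquality using (_≡_; _≢_)

infixr 6 _∧ᶠ_
infixr 5 _∨ᶠ_

data Fm : Set where
  var    : ℕ → Fm
  nvar   : ℕ → Fm
  _∧ᶠ_   : Fm → Fm → Fm
  _∨ᶠ_   : Fm → Fm → Fm

¬ᶠ : Fm → Fm
¬ᶠ (var n)   = nvar n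
¬ᶠ (nvar n)  = var n
¬ᶠ (A ∧ᶠ B)  = ¬ᶠ A ∨ᶠ ¬ᶠ B
¬ᶠ (A ∨ᶠ B)  = ¬ᶠ A ∧ᶠ ¬ᶠ B

eval : (ℕ → Bool) → Fm → Bool
eval v (var n)   = v n
eval v (nvar n)  = not (v n)
eval v (A ∧ᶠ B)  = eval v A ∧ eval v B
eval v (A ∨ᶠ B)  = eval v A ∨ eval v B

Valid : Fm → Set
Valid A = ∀ (v : ℕ → Bool) → eval v A ≡ true

-- Sequents: finite multisets of formulas, represented as lists taken up
-- to permutation (an explicit permutation step is part of every
-- derivation, so derivability only depends on the multiset).

Seq : Set
Seq = List Fm

data RuleName : Set where
  amp tensor blend oplus par W C : RuleName
  -- amp = (&), tensor = (⊗), blend = (∧), oplus = (⊕), par = (par),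
  -- W = weakening, C = contraction

-- A system: the axiom together with the set of rules r with S r ≡ true.
System : Set
System = RuleName → Bool

Standard : System → Set
Standard S = S blend ≡ false

-- Instances of one-premise rules  (premise, conclusion),
-- "Γ , A" written as Γ ++ [ A ].
data Inst₁ : RuleName → Seq → Seq → Set where
  ⊕₁ : ∀ Γ A B → Inst₁ oplus (Γ ++ [ A ]) (Γ ++ [ A ∨ᶠ B ])
  ⊕₂ : ∀ Γ A B → Inst₁ oplus (Γ ++ [ B ]) (Γ ++ [ A ∨ᶠ B ])
  parI : ∀ Γ A B → Inst₁ par (Γ ++ A ∷ B ∷ []) (Γ ++ [ A ∨ᶠ B ])
  WI : ∀ Γ A → Γ ≢ [] → Inst₁ W Γ (Γ ++ [ A ])   -- sequents are nonempty
  CI : ∀ Γ A → Inst₁ C (Γ ++ A ∷ A ∷ []) (Γ ++ [ A ])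

data Inst₂ : RuleName → Seq → Seq → Seq → Set where
  &I : ∀ Γ A B → Inst₂ amp (Γ ++ [ A ]) (Γ ++ [ B ]) (Γ ++ [ A ∧ᶠ B ])
  ⊗I : ∀ Δ Σ' A B → Inst₂ tensor (Δ ++ [ A ]) (Σ' ++ [ B ]) (Δ ++ Σ' ++ [ A ∧ᶠ B ])
  ∧I : ∀ Γ Δ Σ' A B →
       Inst₂ blend (Γ ++ Δ ++ [ A ]) (Γ ++ Σ' ++ [ B ]) (Γ ++ Δ ++ Σ' ++ [ A ∧ᶠ B ])

data Der (S : System) (L : Seq → Set) : Seq → Set where
  leaf : ∀ {Γ} → L Γ → Der S L Γ
  ax   : ∀ n → Der S L (var n ∷ nvar n ∷ [])
  perm : ∀ {Γ Δ} → Der S L Γ → Γ ↭ Δ → Der S L Δ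
  rule₁ : ∀ {r Γ Δ} → S r ≡ true → Inst₁ r Γ Δ → Der S L Γ → Der S L Δ
  rule₂ : ∀ {r Γ₁ Γ₂ Δ} → S r ≡ true → Inst₂ r Γ₁ Γ₂ Δ →
          Der S L Γ₁ → Der S L Γ₂ → Der S L Δ

Derivable : System → Seq → Set
Derivable S = Der S (λ _ → ⊥)

DerivableRule : System → RuleName → Set
DerivableRule S r =
  (∀ Γ Δ → Inst₁ r Γ Δ → Der S (λ Θ → Θ ≡ Γ) Δ) ×
  (∀ Γ₁ Γ₂ Δ → Inst₂ r Γ₁ Γ₂ Δ → Der S (λ Θ → Θ ≡ Γ₁ ⊎ Θ ≡ Γ₂) Δ)

-- S contains T: every rule of T is derivable in S
-- (the axiom is shared by all systems).
Contains : System → System → Set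
Contains S T = ∀ r → T r ≡ true → DerivableRule S r

Equivalent : System → System → Set
Equivalent S T = Contains S T × Contains T S

Complete : System → Set
Complete S = ∀ A → Valid A → Derivable S [ A ]

-- (⊗) is the instance Γ = [] of (∧), and (&) its instance Δ = Σ = [].  Conversely an
-- instance of (∧) is an instance of (⊗) followed by contracting the duplicated context
-- Γ, or an instance of (&) after weakening each premise by the other side context.
-- So (∧) may be replaced by (⊗) and (&) as soon as (C) or (W) is present.
module Submission where

open import Defs
open import Data.Bool using (true; false)
open import Data.Product using (Σ; _×_; _,_)
open import Data.Sum using (_⊎_; inj₁; inj₂)
open import Data.List using ([]; _∷_; _++_; [_])
open import Data.List.Relation.Binary.Permutation.Propositional using (_↭_; ↭-refl)
open import Data.List.Relation.Binary.Permutation.Propositional.Properties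
  using (++-commutativeMonoid)
open import Algebra.Solver.CommutativeMonoid (++-commutativeMonoid {A = Fm})
  using (solve; _⊜_; _⊕_; id)
open import Relation.Binary.PropositionalEquality using (_≡_; refl)

private
  variable
    S : System
    L : Seq → Set
    Γ : Seq
    A : Fm

rule⇒derivable : ∀ {r} → S r ≡ true → DerivableRule S r
rule⇒derivable p = (λ _ _ i → rule₁ p i (leaf refl))
                 , (λ _ _ _ i → rule₂ p i (leaf (inj₁ refl)) (leaf (inj₂ refl)))

contract : S C ≡ true → Der S L (A ∷ A ∷ Γ) → Der S L (A ∷ Γ)
contract {A = A} {Γ = Γ} c d =
  perm (rule₁ c (CI Γ A) (perm d (solve 2 (λ a g → a ⊕ a ⊕ g ⊜ g ⊕ a ⊕ a) ↭-refl [ A ] Γ)))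
       (solve 2 (λ a g → g ⊕ a ⊜ a ⊕ g) ↭-refl [ A ] Γ)

contract-context : S C ≡ true → ∀ Δ → Der S L (Δ ++ Δ ++ Γ) → Der S L (Δ ++ Γ)
contract-context c [] d = d
contract-context {Γ = Γ} c (B ∷ Δ) d =
  contract c (perm (contract-context c Δ (perm d regroup)) ungroup)
  where
  regroup : B ∷ Δ ++ B ∷ Δ ++ Γ ↭ Δ ++ Δ ++ B ∷ B ∷ Γ
  regroup = solve 3 (λ b δ g → b ⊕ δ ⊕ b ⊕ δ ⊕ g ⊜ δ ⊕ δ ⊕ b ⊕ b ⊕ g) ↭-refl [ B ] Δ Γ
  ungroup : Δ ++ B ∷ B ∷ Γ ↭ B ∷ B ∷ Δ ++ Γ
  ungroup = solve 3 (λ b δ g → δ ⊕ b ⊕ b ⊕ g ⊜ b ⊕ b ⊕ δ ⊕ g) ↭-refl [ B ] Δ Γ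

weaken-context : S W ≡ true → ∀ Δ → Der S L (A ∷ Γ) → Der S L (A ∷ Γ ++ Δ)
weaken-context {A = A} {Γ = Γ} w [] d =
  perm d (solve 2 (λ a g → a ⊕ g ⊜ a ⊕ g ⊕ id) ↭-refl [ A ] Γ)
weaken-context {A = A} {Γ = Γ} w (B ∷ Δ) d =
  perm (weaken-context w Δ (rule₁ w (WI (A ∷ Γ) B λ ()) d))
       (solve 4 (λ a g b δ → a ⊕ (g ⊕ b) ⊕ δ ⊜ a ⊕ g ⊕ b ⊕ δ) ↭-refl [ A ] Γ [ B ] Δ)

blend⇒tensor : S blend ≡ true → DerivableRule S tensor
blend⇒tensor b = (λ _ _ ())
  , λ { _ _ _ (⊗I Δ Σ' A B) → rule₂ b (∧I [] Δ Σ' A B) (leaf (inj₁ refl)) (leaf (inj₂ refl)) }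

blend⇒amp : S blend ≡ true → DerivableRule S amp
blend⇒amp b = (λ _ _ ())
  , λ { _ _ _ (&I Γ A B) → rule₂ b (∧I Γ [] [] A B) (leaf (inj₁ refl)) (leaf (inj₂ refl)) }

tensor∧C⇒blend : S tensor ≡ true → S C ≡ true → DerivableRule S blend
tensor∧C⇒blend t c = (λ _ _ ())
  , λ { _ _ _ (∧I Γ Δ Σ' A B) →
          contract-context c Γ
            (perm (rule₂ t (⊗I (Γ ++ Δ) (Γ ++ Σ') A B)
                     (perm (leaf (inj₁ refl)) (reassoc Γ Δ [ A ]))
                     (perm (leaf (inj₂ refl)) (reassoc Γ Σ' [ B ])))
                  (solve 4 (λ g d s ab → (g ⊕ d) ⊕ (g ⊕ s) ⊕ ab ⊜ g ⊕ g ⊕ d ⊕ s ⊕ ab)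
                         ↭-refl Γ Δ Σ' [ A ∧ᶠ B ])) }
  where
  reassoc : ∀ Γ Δ Π → Γ ++ Δ ++ Π ↭ (Γ ++ Δ) ++ Π
  reassoc = solve 3 (λ g d p → g ⊕ d ⊕ p ⊜ (g ⊕ d) ⊕ p) ↭-refl

amp∧W⇒blend : S amp ≡ true → S W ≡ true → DerivableRule S blend
amp∧W⇒blend {S} a w = (λ _ _ ())
  , λ { _ _ _ (∧I Γ Δ Σ' A B) →
          perm (rule₂ a (&I (Γ ++ Δ ++ Σ') A B)
                  (weaken-premise Γ Δ Σ' (leaf (inj₁ refl)))
                  (perm (weaken-premise Γ Σ' Δ (leaf (inj₂ refl)))
                        (solve 4 (λ g s d b → (g ⊕ s ⊕ d) ⊕ b ⊜ (g ⊕ d ⊕ s) ⊕ b)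
                               ↭-refl Γ Σ' Δ [ B ])))
               (solve 4 (λ g d s ab → (g ⊕ d ⊕ s) ⊕ ab ⊜ g ⊕ d ⊕ s ⊕ ab)
                      ↭-refl Γ Δ Σ' [ A ∧ᶠ B ]) }
  where
  weaken-premise : ∀ {L A} Γ Δ Π →
                   Der S L (Γ ++ Δ ++ [ A ]) → Der S L ((Γ ++ Δ ++ Π) ++ [ A ])
  weaken-premise {A = A} Γ Δ Π d =
    perm (weaken-context w Π (perm d (solve 3 (λ g d a → g ⊕ d ⊕ a ⊜ a ⊕ g ⊕ d)
                                            ↭-refl Γ Δ [ A ])))
         (solve 4 (λ a g d p → a ⊕ (g ⊕ d) ⊕ p ⊜ (g ⊕ d ⊕ p) ⊕ a) ↭-refl [ A ] Γ Δ Π)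

withoutBlend : System → System
withoutBlend S blend  = false
withoutBlend S tensor = true
withoutBlend S amp    = true
withoutBlend S oplus  = S oplus
withoutBlend S par    = S par
withoutBlend S W      = S W
withoutBlend S C      = S C

contains-withoutBlend : S blend ≡ true → Contains S (withoutBlend S)
contains-withoutBlend b blend  ()
contains-withoutBlend b tensor _ = blend⇒tensor b
contains-withoutBlend b amp    _ = blend⇒amp b
contains-withoutBlend b oplus  p = rule⇒derivable p
contains-withoutBlend b par    p = rule⇒derivable p
contains-withoutBlend b W      p = rule⇒derivable p
contains-withoutBlend b C      p = rule⇒derivable p

withoutBlend-contains : S C ≡ true ⊎ S W ≡ true → Contains (withoutBlend S) S
withoutBlend-contains (inj₁ c) blend _ = tensor∧C⇒blend refl c
withoutBlend-contains (inj₂ w) blend _ = amp∧W⇒blend refl w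
withoutBlend-contains _ tensor _ = rule⇒derivable refl
withoutBlend-contains _ amp    _ = rule⇒derivable refl
withoutBlend-contains _ oplus  p = rule⇒derivable p
withoutBlend-contains _ par    p = rule⇒derivable p
withoutBlend-contains _ W      p = rule⇒derivable p
withoutBlend-contains _ C      p = rule⇒derivable p

lemma21 : (S : System) → Complete S → S blend ≡ true →
          (S C ≡ true ⊎ S W ≡ true) →
          Σ System (λ T → Standard T × Equivalent S T)
lemma21 S _ b C⊎W =
  withoutBlend S , refl , contains-withoutBlend b , withoutBlend-contains C⊎W
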